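{- Let $F=\{n_F\}_{n\geq 0}$ be a cobweb-admissible sequence of positive integers. Then $F$ is the pointwise product of primary cobweb-admissible sequences: for each prime $p$ there is a primary cobweb-admissible sequence $P(p)=\{n_{P(p)}\}_{n\geq 0}$ whose values lie in $\{1,p,p^2,p^3,\dots\}$, such that for every $n\geq 0$ we have $n_F=\prod_{p \text{ prime}} n_{P(p)}$, where for each fixed $n$ only finitely many factors differ from $1$.
   Context: A sequence $F=\{n_F\}_{n\geq 0}$ of positive integers is called cobweb-admissible if for all integers $0\leq k\leq n$ the $F$-nomial coefficient $$\binom{n}{k}_F=\frac{n_F\cdot (n-1)_F\cdots (n-k+1)_F}{1_F\cdot 2_F\cdots k_F}$$ is a positive integer (the empty product, for $k=0$, equals $1$). For a prime $p$, a primary cobweb-admissible sequence is a cobweb-admissible sequence $\{n_P\}_{n\geq 0}$ all of whose values lie in $\{1,p,p^2,p^3,\dots\}$. -}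

module Defs where

open import Data.Nat using (ℕ; zero; suc; _*_; _∸_; _^_; _<_)
open import Data.Nat.Divisibility using (_∣_)
open import Data.Nat.Primality using (Prime; prime?)
open import Data.Product using (∃; _×_)
open import Relation.Binary.PropositionalEquality using (_≡_)
open import Relation.Nullary using (yes; no)

fallingF : (ℕ → ℕ) → ℕ → ℕ → ℕ
fallingF F n zero    = 1
fallingF F n (suc k) = F n * fallingF F (n ∸ 1) k

factF : (ℕ → ℕ) → ℕ → ℕ
factF F zero    = 1
factF F (suc k) = factF F k * F (suc k)

-- F is a sequence of positive integers, and every F-nomial (n choose k)_F with
-- 0 ≤ k ≤ n is a positive integer, i.e. the denominator divides the numerator
-- (positivity of the quotient follows from positivity of F).
CobwebAdmissible : (ℕ → ℕ) → Set
CobwebAdmissible F =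
  (∀ n → 0 < F n) × (∀ n k → k Data.Nat.≤ n → factF F k ∣ fallingF F n k)

PrimaryCobwebAdmissible : ℕ → (ℕ → ℕ) → Set
PrimaryCobwebAdmissible p P = CobwebAdmissible P × (∀ n → ∃ λ e → P n ≡ p ^ e)

prodPrimesUpTo : ℕ → (ℕ → ℕ) → ℕ
prodPrimesUpTo zero    f = 1
prodPrimesUpTo (suc b) f with prime? (suc b)
... | yes _ = f (suc b) * prodPrimesUpTo b f
... | no  _ = prodPrimesUpTo b f

-- Let the primary sequence for p be the p-part n ↦ p^(v_p(n_F)). The p-part is multiplicative on
-- positive integers, so it turns the numerator and denominator of every F-nomial into their own
-- p-parts, and it preserves divisibility since v_p is monotone along divisibility; hence each p-part
-- sequence is again cobweb-admissible. Factorising n_F into primes gives n_F = ∏_{p ≤ n_F} p^(v_p(n_F)).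
module Submission where

open import Defs
open import Data.Nat.Base
  using (ℕ; zero; suc; _∸_; _+_; _*_; _^_; _≤_; _<_; s≤s; z<s; NonZero; NonTrivial; >-nonZero; >-nonZero⁻¹)
open import Data.Nat.Properties
open import Data.Nat.Divisibility
open import Data.Nat.Primality
  using (Prime; prime?; euclidsLemma; productOfPrimes≢0; prime⇒irreducible; prime⇒nonZero; prime⇒nonTrivial
        ; ¬prime[0]; ¬prime[1])
open import Data.Nat.Primality.Factorisation using (PrimeFactorisation; factorise)
open import Data.Nat.ListAction using (product)
open import Data.Nat.ListAction.Properties using (∈⇒≤product)
open import Data.Nat.Solver using (module +-*-Solver)
open import Data.List.Base using ([]; _∷_)
open import Data.List.Relation.Unary.All as All using (All; []; _∷_)
open import Data.Product using (Σ; ∃; _×_; _,_)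
open import Data.Sum using (inj₁; inj₂)
open import Data.Empty using (⊥-elim)
open import Function.Base using (_∘_)
open import Relation.Nullary using (yes; no)
open import Relation.Nullary.Negation using (contradiction)
open import Relation.Binary.PropositionalEquality
  using (_≡_; _≢_; refl; sym; trans; cong; cong₂; subst; subst₂; module ≡-Reasoning)

open +-*-Solver using (solve; _:*_; _:=_)

*-pos : ∀ {a b} → 0 < a → 0 < b → 0 < a * b
*-pos {suc a} {suc b} _ _ = z<s

^-monoʳ-∣ : ∀ m {n o} → n ≤ o → m ^ n ∣ m ^ o
^-monoʳ-∣ m {n} {o} n≤o = divides (m ^ (o ∸ n)) (begin
  m ^ o            ≡⟨ cong (m ^_) (sym (m∸n+n≡m n≤o)) ⟩
  m ^ (o ∸ n + n)  ≡⟨ ^-distribˡ-+-* m (o ∸ n) n ⟩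
  m ^ (o ∸ n) * m ^ n ∎)
  where open ≡-Reasoning

interchange-* : ∀ a b c d → a * b * (c * d) ≡ a * c * (b * d)
interchange-* = solve 4 (λ a b c d → a :* b :* (c :* d) := a :* c :* (b :* d)) refl

prime∤1 : ∀ {p} → Prime p → p ∤ 1
prime∤1 p-prime p∣1 = ¬prime[1] (subst Prime (∣1⇒≡1 p∣1) p-prime)

prime∤prime : ∀ {p q} → Prime p → Prime q → p ≢ q → p ∤ q
prime∤prime p-prime q-prime p≢q p∣q with prime⇒irreducible q-prime p∣q
... | inj₁ p≡1 = ¬prime[1] (subst Prime p≡1 p-prime)
... | inj₂ p≡q = p≢q p≡q

record ExactPower (p e a : ℕ) : Set where
  constructor exactPower
  field
    cofactor   : ℕ
    factorises : a ≡ p ^ e * cofactor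
    p∤cofactor : p ∤ cofactor

-- Each division by p strictly decreases a > 0, so a steps of fuel suffice.
valuationWithFuel : ℕ → ℕ → ℕ → ℕ
valuationWithFuel zero    p a = 0
valuationWithFuel (suc k) p a with p ∣? a
... | yes p∣a = suc (valuationWithFuel k p (quotient p∣a))
... | no  _   = 0

valuation : ℕ → ℕ → ℕ
valuation p a = valuationWithFuel a p a

pPart : ℕ → ℕ → ℕ
pPart p a = p ^ valuation p a

∤⇒exactPower0 : ∀ {p a} → p ∤ a → ExactPower p 0 a
∤⇒exactPower0 {a = a} p∤a = exactPower a (sym (*-identityˡ a)) p∤a

exactPower⇒∣ : ∀ {p e a} → ExactPower p e a → p ^ e ∣ a
exactPower⇒∣ (exactPower m refl _) = m∣m*n m

∣-exactPower⇒≤ : ∀ {p e f a} .{{_ : NonZero p}} → p ^ e ∣ a → ExactPower p f a → e ≤ f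
∣-exactPower⇒≤ {p} {e} {f} pᵉ∣a (exactPower m refl p∤m) with e ≤? f
... | yes e≤f = e≤f
... | no  e≰f = contradiction (*-cancelˡ-∣ (p ^ f) {{m^n≢0 p f}} pᶠ⁺¹∣pᶠm) p∤m
  where
  pᶠ⁺¹∣pᶠm : p ^ f * p ∣ p ^ f * m
  pᶠ⁺¹∣pᶠm = ∣-trans (subst (_∣ p ^ e) (*-comm p (p ^ f)) (^-monoʳ-∣ p (≰⇒> e≰f))) pᵉ∣a

exactPower-unique : ∀ {p e f a} .{{_ : NonZero p}} → ExactPower p e a → ExactPower p f a → e ≡ f
exactPower-unique pᵉ‖a pᶠ‖a =
  ≤-antisym (∣-exactPower⇒≤ (exactPower⇒∣ pᵉ‖a) pᶠ‖a) (∣-exactPower⇒≤ (exactPower⇒∣ pᶠ‖a) pᵉ‖a)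

module _ {p : ℕ} (p-prime : Prime p) where

  private instance
    p≢0 : NonZero p
    p≢0 = prime⇒nonZero p-prime

  exactPower-* : ∀ {e f a b} → ExactPower p e a → ExactPower p f b → ExactPower p (e + f) (a * b)
  exactPower-* {e} {f} (exactPower m refl p∤m) (exactPower n refl p∤n) = exactPower (m * n) a*b≡ p∤m*n
    where
    open ≡-Reasoning
    a*b≡ : p ^ e * m * (p ^ f * n) ≡ p ^ (e + f) * (m * n)
    a*b≡ = begin
      p ^ e * m * (p ^ f * n)   ≡⟨ interchange-* (p ^ e) m (p ^ f) n ⟩
      p ^ e * p ^ f * (m * n)   ≡⟨ cong (_* (m * n)) (sym (^-distribˡ-+-* p e f)) ⟩
      p ^ (e + f) * (m * n)     ∎
    p∤m*n : p ∤ m * n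
    p∤m*n p∣m*n with euclidsLemma m n p-prime p∣m*n
    ... | inj₁ p∣m = p∤m p∣m
    ... | inj₂ p∣n = p∤n p∣n

  p¹‖p : ExactPower p 1 p
  p¹‖p = exactPower 1 (sym (trans (*-identityʳ (p * 1)) (*-identityʳ p))) (prime∤1 p-prime)

  exactPower-valuationWithFuel : ∀ k {a} → 0 < a → a ≤ k → ExactPower p (valuationWithFuel k p a) a
  exactPower-valuationWithFuel zero    a>0 a≤0 = ⊥-elim (<⇒≱ a>0 a≤0)
  exactPower-valuationWithFuel (suc k) {a} a>0 a≤k with p ∣? a
  ... | no  p∤a = ∤⇒exactPower0 p∤a
  ... | yes p∣a = subst (λ x → ExactPower p _ x) (sym (m∣n⇒n≡m*quotient p∣a))
                    (exactPower-* p¹‖p pᵉ‖q)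
    where
    instance
      p>1 : NonTrivial p
      p>1 = prime⇒nonTrivial p-prime
      a≢0 : NonZero a
      a≢0 = >-nonZero a>0
    pᵉ‖q : ExactPower p (valuationWithFuel k p (quotient p∣a)) (quotient p∣a)
    pᵉ‖q = exactPower-valuationWithFuel k (>-nonZero⁻¹ _ {{quotient≢0 p∣a}}) (≤-pred (≤-trans (quotient-< p∣a) a≤k))

  exactPower-valuation : ∀ {a} → 0 < a → ExactPower p (valuation p a) a
  exactPower-valuation {a} a>0 = exactPower-valuationWithFuel a a>0 ≤-refl

  valuation-exactPower : ∀ {e a} → 0 < a → ExactPower p e a → valuation p a ≡ e
  valuation-exactPower a>0 = exactPower-unique (exactPower-valuation a>0)

  valuation-* : ∀ {a b} → 0 < a → 0 < b → valuation p (a * b) ≡ valuation p a + valuation p b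
  valuation-* a>0 b>0 = valuation-exactPower (*-pos a>0 b>0)
    (exactPower-* (exactPower-valuation a>0) (exactPower-valuation b>0))

  valuation-mono-∣ : ∀ {a b} → 0 < a → 0 < b → a ∣ b → valuation p a ≤ valuation p b
  valuation-mono-∣ a>0 b>0 a∣b =
    ∣-exactPower⇒≤ (∣-trans (exactPower⇒∣ (exactPower-valuation a>0)) a∣b) (exactPower-valuation b>0)

  ∤⇒valuation≡0 : ∀ {a} → 0 < a → p ∤ a → valuation p a ≡ 0
  ∤⇒valuation≡0 a>0 p∤a = valuation-exactPower a>0 (∤⇒exactPower0 p∤a)

  pPart>0 : ∀ a → 0 < pPart p a
  pPart>0 a = m^n>0 p (valuation p a)

  pPart[1] : pPart p 1 ≡ 1
  pPart[1] = cong (p ^_) (∤⇒valuation≡0 z<s (prime∤1 p-prime))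

  pPart-* : ∀ {a b} → 0 < a → 0 < b → pPart p (a * b) ≡ pPart p a * pPart p b
  pPart-* {a} {b} a>0 b>0 =
    trans (cong (p ^_) (valuation-* a>0 b>0)) (^-distribˡ-+-* p (valuation p a) (valuation p b))

  pPart-mono-∣ : ∀ {a b} → 0 < a → 0 < b → a ∣ b → pPart p a ∣ pPart p b
  pPart-mono-∣ a>0 b>0 a∣b = ^-monoʳ-∣ p (valuation-mono-∣ a>0 b>0 a∣b)

  pPart-< : ∀ {a} → 0 < a → a < p → pPart p a ≡ 1
  pPart-< a>0 a<p = cong (p ^_) (∤⇒valuation≡0 a>0 (λ p∣a → <⇒≱ a<p (∣⇒≤ {{>-nonZero a>0}} p∣a)))

  pPart[p] : pPart p p ≡ p
  pPart[p] = trans (cong (p ^_) (valuation-exactPower (>-nonZero⁻¹ p) p¹‖p)) (*-identityʳ p)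

  pPart[q] : ∀ {q} → Prime q → p ≢ q → pPart p q ≡ 1
  pPart[q] q-prime p≢q = cong (p ^_)
    (∤⇒valuation≡0 (>-nonZero⁻¹ _ {{prime⇒nonZero q-prime}}) (prime∤prime p-prime q-prime p≢q))

module _ {F : ℕ → ℕ} (F>0 : ∀ n → 0 < F n) where

  factF>0 : ∀ k → 0 < factF F k
  factF>0 zero    = z<s
  factF>0 (suc k) = *-pos (factF>0 k) (F>0 (suc k))

  fallingF>0 : ∀ n k → 0 < fallingF F n k
  fallingF>0 n zero    = z<s
  fallingF>0 n (suc k) = *-pos (F>0 n) (fallingF>0 (n ∸ 1) k)

  module _ {g : ℕ → ℕ} (g[1] : g 1 ≡ 1) (g-* : ∀ {a b} → 0 < a → 0 < b → g (a * b) ≡ g a * g b) where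

    factF-∘ : ∀ k → factF (g ∘ F) k ≡ g (factF F k)
    factF-∘ zero    = sym g[1]
    factF-∘ (suc k) = trans (cong (_* g (F (suc k))) (factF-∘ k)) (sym (g-* (factF>0 k) (F>0 (suc k))))

    fallingF-∘ : ∀ n k → fallingF (g ∘ F) n k ≡ g (fallingF F n k)
    fallingF-∘ n zero    = sym g[1]
    fallingF-∘ n (suc k) = trans (cong (g (F n) *_) (fallingF-∘ (n ∸ 1) k)) (sym (g-* (F>0 n) (fallingF>0 (n ∸ 1) k)))

    cobwebAdmissible-∘ : (∀ a → 0 < g a) → (∀ {a b} → 0 < a → 0 < b → a ∣ b → g a ∣ g b) →
                         (∀ n k → k ≤ n → factF F k ∣ fallingF F n k) → CobwebAdmissible (g ∘ F)
    cobwebAdmissible-∘ g>0 g-mono-∣ F-adm = (λ n → g>0 (F n)) , λ n k k≤n →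
      subst₂ _∣_ (sym (factF-∘ k)) (sym (fallingF-∘ n k))
        (g-mono-∣ (factF>0 k) (fallingF>0 n k) (F-adm n k k≤n))

primaryCobwebAdmissible-pPart : ∀ {F p} → Prime p → CobwebAdmissible F → PrimaryCobwebAdmissible p (pPart p ∘ F)
primaryCobwebAdmissible-pPart {F} {p} p-prime (F>0 , F-adm) =
  cobwebAdmissible-∘ F>0 (pPart[1] p-prime) (pPart-* p-prime) (pPart>0 p-prime) (pPart-mono-∣ p-prime) F-adm ,
  λ n → valuation p (F n) , refl

prodPrimesUpTo-cong : ∀ B {f g} → (∀ {p} → Prime p → p ≤ B → f p ≡ g p) → prodPrimesUpTo B f ≡ prodPrimesUpTo B g
prodPrimesUpTo-cong zero    f≗g = refl
prodPrimesUpTo-cong (suc b) f≗g with prime? (suc b)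
... | yes b+1-prime = cong₂ _*_ (f≗g b+1-prime ≤-refl) (prodPrimesUpTo-cong b (λ p-prime → f≗g p-prime ∘ m≤n⇒m≤1+n))
... | no  _         = prodPrimesUpTo-cong b (λ p-prime → f≗g p-prime ∘ m≤n⇒m≤1+n)

prodPrimesUpTo-1 : ∀ B → prodPrimesUpTo B (λ _ → 1) ≡ 1
prodPrimesUpTo-1 zero    = refl
prodPrimesUpTo-1 (suc b) with prime? (suc b)
... | yes _ = trans (*-identityˡ _) (prodPrimesUpTo-1 b)
... | no  _ = prodPrimesUpTo-1 b

prodPrimesUpTo-trivial : ∀ B {f} → (∀ {p} → Prime p → p ≤ B → f p ≡ 1) → prodPrimesUpTo B f ≡ 1
prodPrimesUpTo-trivial B f≗1 = trans (prodPrimesUpTo-cong B f≗1) (prodPrimesUpTo-1 B)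

prodPrimesUpTo-* : ∀ B f g → prodPrimesUpTo B (λ p → f p * g p) ≡ prodPrimesUpTo B f * prodPrimesUpTo B g
prodPrimesUpTo-* zero    f g = refl
prodPrimesUpTo-* (suc b) f g with prime? (suc b)
... | yes _ = trans (cong (f (suc b) * g (suc b) *_) (prodPrimesUpTo-* b f g))
                    (interchange-* (f (suc b)) (g (suc b)) (prodPrimesUpTo b f) (prodPrimesUpTo b g))
... | no  _ = prodPrimesUpTo-* b f g

prodPrimesUpTo-single : ∀ B {f q} → Prime q → q ≤ B → (∀ {p} → Prime p → p ≤ B → p ≢ q → f p ≡ 1) →
                        prodPrimesUpTo B f ≡ f q
prodPrimesUpTo-single zero    q-prime q≤0 _ = ⊥-elim (¬prime[0] (subst Prime (n≤0⇒n≡0 q≤0) q-prime))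
prodPrimesUpTo-single (suc b) {f} {q} q-prime q≤b+1 f≗1 with prime? (suc b) | suc b ≟ q
... | yes _ | yes refl = trans (cong (f q *_) (prodPrimesUpTo-trivial b λ p-prime p≤b →
                           f≗1 p-prime (m≤n⇒m≤1+n p≤b) (<⇒≢ (s≤s p≤b)))) (*-identityʳ (f q))
... | no  ¬b+1-prime | yes refl = contradiction q-prime ¬b+1-prime
... | yes b+1-prime | no b+1≢q = trans (cong₂ _*_ (f≗1 b+1-prime ≤-refl b+1≢q) (prodPrimesUpTo-single b q-prime q≤b
                                   (λ p-prime → f≗1 p-prime ∘ m≤n⇒m≤1+n))) (*-identityˡ (f q))
  where
  q≤b : q ≤ b
  q≤b = ≤-pred (≤∧≢⇒< q≤b+1 (b+1≢q ∘ sym))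
... | no  _ | no b+1≢q = prodPrimesUpTo-single b q-prime (≤-pred (≤∧≢⇒< q≤b+1 (b+1≢q ∘ sym)))
                           (λ p-prime → f≗1 p-prime ∘ m≤n⇒m≤1+n)

prodPrimesUpTo-pPart-product : ∀ B {as} → All Prime as → All (_≤ B) as →
                               prodPrimesUpTo B (λ p → pPart p (product as)) ≡ product as
prodPrimesUpTo-pPart-product B [] [] = prodPrimesUpTo-trivial B (λ p-prime _ → pPart[1] p-prime)
prodPrimesUpTo-pPart-product B {q ∷ as} (q-prime ∷ as-prime) (q≤B ∷ as≤B) = begin
  prodPrimesUpTo B (λ p → pPart p (q * product as))
    ≡⟨ prodPrimesUpTo-cong B (λ p-prime _ → pPart-* p-prime q>0 (>-nonZero⁻¹ _ {{productOfPrimes≢0 as-prime}})) ⟩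
  prodPrimesUpTo B (λ p → pPart p q * pPart p (product as))
    ≡⟨ prodPrimesUpTo-* B _ _ ⟩
  prodPrimesUpTo B (λ p → pPart p q) * prodPrimesUpTo B (λ p → pPart p (product as))
    ≡⟨ cong₂ _*_ Π[q] (prodPrimesUpTo-pPart-product B as-prime as≤B) ⟩
  q * product as ∎
  where
  open ≡-Reasoning
  q>0 : 0 < q
  q>0 = >-nonZero⁻¹ q {{prime⇒nonZero q-prime}}
  Π[q] : prodPrimesUpTo B (λ p → pPart p q) ≡ q
  Π[q] = trans (prodPrimesUpTo-single B q-prime q≤B (λ p-prime _ → pPart[q] p-prime q-prime)) (pPart[p] q-prime)

prodPrimesUpTo-pPart : ∀ {a} → 0 < a → prodPrimesUpTo a (λ p → pPart p a) ≡ a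
prodPrimesUpTo-pPart {a} a>0 = subst (λ x → prodPrimesUpTo x (λ p → pPart p x) ≡ x) (sym isFactorisation)
  (prodPrimesUpTo-pPart-product _ factorsPrime (All.tabulate (∈⇒≤product (All.map prime⇒nonZero factorsPrime))))
  where open PrimeFactorisation (factorise a {{>-nonZero a>0}})

theorem1 : (F : ℕ → ℕ) → CobwebAdmissible F →
    Σ (ℕ → ℕ → ℕ) λ P →
      (∀ p → Prime p → PrimaryCobwebAdmissible p (P p)) ×
      (∀ n → ∃ λ B →
        (∀ p → Prime p → B < p → P p n ≡ 1) ×
        F n ≡ prodPrimesUpTo B (λ p → P p n))
theorem1 F F-adm@(F>0 , _) =
  (λ p → pPart p ∘ F) ,
  (λ p p-prime → primaryCobwebAdmissible-pPart p-prime F-adm) ,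
  λ n → F n , (λ p p-prime → pPart-< p-prime (F>0 n)) , sym (prodPrimesUpTo-pPart (F>0 n))
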